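{- Let $n$ be a positive integer and $\lambda$ an integer partition with parts $\lambda_1\ge\lambda_2\ge\cdots$. Then $c_n(c_n(\lambda))=\lambda$ if and only if for every integer $k\ge 0$ there is at most one index $i$ such that $kn<\lambda_i<(k+1)n$.
   Context: For a positive integer $n$ and an integer partition $\lambda$, $c_n(\lambda)$ is the integer partition $\mu=(\mu_1,\mu_2,\dots,\mu_k)$ (of the same size as $\lambda$) whose $i$-th part $\mu_i$ is the sum of the lengths of the columns of the Young shape of $\lambda$ numbered from $(i-1)n+1$ to $in$ (columns numbered from left to right; $k$ is the number of nonzero such sums). For example $c_3((7,6,6,6,4,3,3,1))=(22,13,1)$, and $c_1$ is conjugation. -}

module Defs where

open import Data.Nat using (ℕ; zero; suc; _+_; _*_; _≤_; _<_; _≥_; _≤?_; _≟_)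
open import Data.List using (List; []; _∷_; length; filter; map; upTo; lookup)
open import Data.Nat.ListAction using (sum)
open import Data.List.Relation.Unary.All using (All)
open import Data.List.Relation.Unary.Linked using (Linked)
open import Data.Fin using (Fin)
open import Relation.Nullary using (¬_)
open import Relation.Nullary.Decidable using (¬?)
open import Relation.Binary.PropositionalEquality using (_≡_)

IsPartition : List ℕ → Set
IsPartition λs = Linked _≥_ λs × All (λ x → 1 ≤ x) λs
  where open import Data.Product using (_×_)

firstPart : List ℕ → ℕ
firstPart []      = 0
firstPart (x ∷ _) = x

-- length of the j-th column (j ≥ 1) of the Young shape: number of parts ≥ j
col : List ℕ → ℕ → ℕ
col λs j = length (filter (j ≤?_) λs)

-- sum of the lengths of columns (i-1)n+1, …, in, with g = i - 1
groupSum : ℕ → List ℕ → ℕ → ℕ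
groupSum n λs g = sum (map (λ t → col λs (g * n + suc t)) (upTo n))

-- Groups beyond λ₁ are all zero (λ₁ ≥ number of nonzero groups), and the
-- group sums are weakly decreasing, so the nonzero ones form an initial segment.
cn : ℕ → List ℕ → List ℕ
cn n λs = filter (λ x → ¬? (x ≟ 0)) (map (groupSum n λs) (upTo (firstPart λs)))

AtMostOnePerWindow : ℕ → List ℕ → Set
AtMostOnePerWindow n λs =
  (k : ℕ) (i j : Fin (length λs)) →
  k * n < lookup λs i → lookup λs i < suc k * n →
  k * n < lookup λs j → lookup λs j < suc k * n →
  i ≡ j

module Submission where

-- Write μ_g = groupSum n λ g for the g-th group sum (g counted from 0), so
-- c_n(λ) is the list of nonzero μ_g.  Both directions rest on it.
--
-- For ANY list λ, consecutive group sums are "separated": if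
-- kn < μ_{g+1} then (k+1)n ≤ μ_g, because with A the number of parts
-- ≥ (g+1)n we have μ_{g+1} ≤ An ≤ μ_g.  Separation is transitive and forbids
-- two numbers in one window, so every c_n(λ) has at most one part per window;
-- an involutive λ = c_n(c_n(λ)) is such an image.
--
-- Under the window condition a duality holds for 1 ≤ u ≤ n:
-- gn + u ≤ λ_h  ⇔  hn + u ≤ μ_g.  Hence column hn + u of μ = c_n(λ) has as
-- many cells as there are groups g with gn + u ≤ λ_h; summing over u and
-- exchanging the sums gives c_n(μ)_h = Σ_g min(n, λ_h ∸ gn) = λ_h, and
-- dropping the zero groups returns exactly λ.

open import Defs
open import Data.Nat
open import Data.Nat.Properties
open import Data.Nat.ListAction using (sum)
open import Data.List using (List; []; _∷_; length; filter; map; upTo; lookup; applyUpTo)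
open import Data.List.Properties using (map-upTo; map-cong)
open import Data.List.Relation.Unary.All as All using (All; []; _∷_)
open import Data.List.Relation.Unary.AllPairs as AllPairs using (AllPairs; []; _∷_)
open import Data.List.Relation.Unary.Linked using (Linked)
open import Data.List.Relation.Unary.Linked.Properties
  using (Linked⇒AllPairs; filter⁺; applyUpTo⁺₂)
open import Data.Fin as Fin using (Fin)
open import Data.Fin.Properties using () renaming (suc-injective to Fin-suc-injective)
open import Data.Product using (_×_; _,_)
open import Data.Empty using (⊥; ⊥-elim)
open import Data.Bool using (true; false; if_then_else_)
open import Relation.Nullary using (Dec; yes; no; ¬_; contradiction; ofʸ; ofⁿ)
open import Relation.Nullary.Decidable using (¬?)
open import Relation.Binary.PropositionalEquality
  using (_≡_; _≢_; refl; sym; trans; cong; cong₂; subst; subst₂; module ≡-Reasoning)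
open import Algebra.Properties.CommutativeSemigroup +-commutativeSemigroup using (interchange)
open import Function using (_∘_)
open import Function.Bundles using (_⇔_; mk⇔)

sumTo : (ℕ → ℕ) → ℕ → ℕ
sumTo f n = sum (applyUpTo f n)

sumTo-cong : ∀ {f g} n → (∀ t → t < n → f t ≡ g t) → sumTo f n ≡ sumTo g n
sumTo-cong zero    f≡g = refl
sumTo-cong (suc n) f≡g =
  cong₂ _+_ (f≡g 0 (s≤s z≤n)) (sumTo-cong n (λ t t<n → f≡g (suc t) (s≤s t<n)))

sumTo-zero : ∀ {f} n → (∀ t → f t ≡ 0) → sumTo f n ≡ 0
sumTo-zero zero    f≡0 = refl
sumTo-zero (suc n) f≡0 = cong₂ _+_ (f≡0 0) (sumTo-zero n (f≡0 ∘ suc))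

sumTo-+ : ∀ f g n → sumTo (λ t → f t + g t) n ≡ sumTo f n + sumTo g n
sumTo-+ f g zero    = refl
sumTo-+ f g (suc n) =
  trans (cong ((f 0 + g 0) +_) (sumTo-+ (f ∘ suc) (g ∘ suc) n))
        (interchange (f 0) (g 0) _ _)

sumTo-swap : ∀ (F : ℕ → ℕ → ℕ) m n →
  sumTo (λ t → sumTo (F t) n) m ≡ sumTo (λ g → sumTo (λ t → F t g) m) n
sumTo-swap F m zero    = sumTo-zero m (λ _ → refl)
sumTo-swap F m (suc n) =
  trans (sumTo-+ (λ t → F t 0) (λ t → sumTo (F t ∘ suc) n) m)
        (cong (sumTo (λ t → F t 0) m +_) (sumTo-swap (λ t → F t ∘ suc) m n))

-- Column lengths as sums of indicators

[_≤_] : ℕ → ℕ → ℕ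
[ a ≤ b ] = if a ≤ᵇ b then 1 else 0

[≤]-yes : ∀ {a b} → a ≤ b → [ a ≤ b ] ≡ 1
[≤]-yes {a} {b} a≤b with a ≤ᵇ b | ≤ᵇ-reflects-≤ a b
... | true  | _        = refl
... | false | ofⁿ a≰b = contradiction a≤b a≰b

[≤]-no : ∀ {a b} → ¬ a ≤ b → [ a ≤ b ] ≡ 0
[≤]-no {a} {b} a≰b with a ≤ᵇ b | ≤ᵇ-reflects-≤ a b
... | true  | ofʸ a≤b = contradiction a≤b a≰b
... | false | _        = refl

[≤]-cong : ∀ {a b c d} → (a ≤ b → c ≤ d) → (c ≤ d → a ≤ b) →
           [ a ≤ b ] ≡ [ c ≤ d ]
[≤]-cong {a} {b} to from with a ≤? b
... | yes a≤b = trans ([≤]-yes a≤b) (sym ([≤]-yes (to a≤b)))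
... | no  a≰b = trans ([≤]-no a≰b) (sym ([≤]-no (a≰b ∘ from)))

[≤]-suc : ∀ a b → [ suc a ≤ suc b ] ≡ [ a ≤ b ]
[≤]-suc a b = [≤]-cong {suc a} {suc b} {a} {b} s≤s⁻¹ s≤s

col-∷ : ∀ x xs j → col (x ∷ xs) j ≡ [ j ≤ x ] + col xs j
col-∷ x xs j with j ≤ᵇ x
... | true  = refl
... | false = refl

sumTo-[≤] : ∀ n a x → sumTo (λ t → [ a + suc t ≤ x ]) n ≡ n ⊓ (x ∸ a)
sumTo-[≤] zero    a       x       = refl
sumTo-[≤] (suc n) zero    zero    = sumTo-zero n (λ _ → refl)
sumTo-[≤] (suc n) zero    (suc x) = cong suc (sumTo-[≤] n zero x)
sumTo-[≤] (suc n) (suc a) zero    = sumTo-zero n (λ _ → refl)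
sumTo-[≤] (suc n) (suc a) (suc x) =
  trans (sumTo-cong (suc n) (λ t _ → [≤]-suc (a + suc t) x)) (sumTo-[≤] (suc n) a x)

-- Group sums as sums of per-part contributions

-- Number of cells that a part x puts into columns gn+1, …, gn+n.
contribution : ℕ → ℕ → ℕ → ℕ
contribution n g x = n ⊓ (x ∸ g * n)

groupSum-columns : ∀ n L g → groupSum n L g ≡ sumTo (λ t → col L (g * n + suc t)) n
groupSum-columns n L g = cong sum (map-upTo _ n)

groupSum-[] : ∀ n g → groupSum n [] g ≡ 0
groupSum-[] n g = trans (groupSum-columns n [] g) (sumTo-zero n (λ _ → refl))

groupSum-∷ : ∀ n x xs g → groupSum n (x ∷ xs) g ≡ contribution n g x + groupSum n xs g
groupSum-∷ n x xs g = begin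
  groupSum n (x ∷ xs) g
    ≡⟨ groupSum-columns n (x ∷ xs) g ⟩
  sumTo (λ t → col (x ∷ xs) (g * n + suc t)) n
    ≡⟨ sumTo-cong n (λ t _ → col-∷ x xs _) ⟩
  sumTo (λ t → [ g * n + suc t ≤ x ] + col xs (g * n + suc t)) n
    ≡⟨ sumTo-+ _ _ n ⟩
  sumTo (λ t → [ g * n + suc t ≤ x ]) n + sumTo (λ t → col xs (g * n + suc t)) n
    ≡⟨ cong₂ _+_ (sumTo-[≤] n (g * n) x) (sym (groupSum-columns n xs g)) ⟩
  contribution n g x + groupSum n xs g ∎
  where open ≡-Reasoning

contribution-below : ∀ n g {x} → x ≤ g * n → contribution n g x ≡ 0
contribution-below n g x≤gn = trans (cong (n ⊓_) (m≤n⇒m∸n≡0 x≤gn)) (⊓-zeroʳ n)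

contribution-above : ∀ n g {x} → suc g * n ≤ x → contribution n g x ≡ n
contribution-above n g sgn≤x = m≤n⇒m⊓n≡m (m+n≤o⇒m≤o∸n n sgn≤x)

≢0? : (x : ℕ) → Dec (¬ (x ≡ 0))
≢0? x = ¬? (x ≟ 0)

groupSum-below : ∀ n g {L} → All (_≤ g * n) L → groupSum n L g ≡ 0
groupSum-below n g {[]}     []           = groupSum-[] n g
groupSum-below n g {x ∷ xs} (x≤ ∷ xs≤) =
  trans (groupSum-∷ n x xs g) (cong₂ _+_ (contribution-below n g x≤) (groupSum-below n g xs≤))

sumTo-contribution : ∀ n M x → x ≤ M * n → sumTo (λ g → contribution n g x) M ≡ x
sumTo-contribution n zero    x x≤0 = sym (n≤0⇒n≡0 x≤0)
sumTo-contribution n (suc M) x x≤ = begin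
  n ⊓ x + sumTo (λ g → contribution n (suc g) x) M
    ≡⟨ cong (n ⊓ x +_) (sumTo-cong M (λ g _ →
         cong (n ⊓_) (sym (∸-+-assoc x n (g * n))))) ⟩
  n ⊓ x + sumTo (λ g → contribution n g (x ∸ n)) M
    ≡⟨ cong (n ⊓ x +_) (sumTo-contribution n M (x ∸ n) x∸n≤) ⟩
  n ⊓ x + (x ∸ n)
    ≡⟨ m⊓n+n∸m≡n n x ⟩
  x ∎
  where
  open ≡-Reasoning
  x∸n≤ : x ∸ n ≤ M * n
  x∸n≤ = subst (x ∸ n ≤_) (m+n∸m≡n n (M * n)) (∸-monoˡ-≤ n x≤)

InWindow : ℕ → ℕ → ℕ → Set
InWindow n k x = k * n < x × x < suc k * n

Apart : ℕ → ℕ → ℕ → Set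
Apart n x y = ∀ k → InWindow n k x → InWindow n k y → ⊥

all-lookup : ∀ {P : ℕ → Set} {xs} → All P xs → (i : Fin (length xs)) → P (lookup xs i)
all-lookup (px ∷ _)   Fin.zero    = px
all-lookup (_  ∷ pxs) (Fin.suc i) = all-lookup pxs i

all-tabulate : ∀ {P : ℕ → Set} xs → ((i : Fin (length xs)) → P (lookup xs i)) → All P xs
all-tabulate []       f = []
all-tabulate (x ∷ xs) f = f Fin.zero ∷ all-tabulate xs (f ∘ Fin.suc)

pairwiseApart⇒atMostOne : ∀ n L → AllPairs (Apart n) L → AtMostOnePerWindow n L
pairwiseApart⇒atMostOne n (x ∷ xs) (x#xs ∷ xs#) k Fin.zero    Fin.zero    a b c d = refl
pairwiseApart⇒atMostOne n (x ∷ xs) (x#xs ∷ xs#) k Fin.zero    (Fin.suc j) a b c d =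
  ⊥-elim (all-lookup x#xs j k (a , b) (c , d))
pairwiseApart⇒atMostOne n (x ∷ xs) (x#xs ∷ xs#) k (Fin.suc i) Fin.zero    a b c d =
  ⊥-elim (all-lookup x#xs i k (c , d) (a , b))
pairwiseApart⇒atMostOne n (x ∷ xs) (x#xs ∷ xs#) k (Fin.suc i) (Fin.suc j) a b c d =
  cong Fin.suc (pairwiseApart⇒atMostOne n xs xs# k i j a b c d)

atMostOne⇒pairwiseApart : ∀ n L → AtMostOnePerWindow n L → AllPairs (Apart n) L
atMostOne⇒pairwiseApart n []       once = []
atMostOne⇒pairwiseApart n (x ∷ xs) once =
  all-tabulate xs (λ j k (a , b) (c , d) → zero≢suc (once k Fin.zero (Fin.suc j) a b c d))
  ∷ atMostOne⇒pairwiseApart n xs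
      (λ k i j a b c d → Fin-suc-injective (once k (Fin.suc i) (Fin.suc j) a b c d))
  where
  zero≢suc : ∀ {m} {j : Fin m} → Fin.zero ≢ Fin.suc j
  zero≢suc ()

-- Necessity: every c_n(λ) has at most one part per window

Separated : ℕ → ℕ → ℕ → Set
Separated n a b = ∀ k → k * n < b → suc k * n ≤ a

separated-trans : ∀ n → 1 ≤ n → ∀ {a b c} →
                  Separated n a b → Separated n b c → Separated n a c
separated-trans n 1≤n a⋙b b⋙c k kn<c =
  a⋙b k (<-≤-trans (+-monoˡ-≤ (k * n) 1≤n) (b⋙c k kn<c))

separated⇒apart : ∀ {n a b} → Separated n a b → Apart n a b
separated⇒apart a⋙b k (_ , a<) (kn<b , _) = <⇒≱ a< (a⋙b k kn<b)

contribution-next≤ : ∀ n g x → contribution n (suc g) x ≤ [ suc g * n ≤ x ] * n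
contribution-next≤ n g x with suc g * n ≤? x
... | yes ≤x rewrite [≤]-yes ≤x =
  subst (contribution n (suc g) x ≤_) (sym (+-identityʳ n)) (m⊓n≤m n _)
... | no  ≰x rewrite [≤]-no ≰x =
  ≤-reflexive (contribution-below n (suc g) (<⇒≤ (≰⇒> ≰x)))

contribution-this≥ : ∀ n g x → [ suc g * n ≤ x ] * n ≤ contribution n g x
contribution-this≥ n g x with suc g * n ≤? x
... | yes ≤x rewrite [≤]-yes ≤x =
  subst (_≤ contribution n g x) (sym (+-identityʳ n))
        (≤-reflexive (sym (contribution-above n g ≤x)))
... | no  ≰x rewrite [≤]-no ≰x = z≤n

col-∷-* : ∀ n x xs j → col (x ∷ xs) j * n ≡ [ j ≤ x ] * n + col xs j * n
col-∷-* n x xs j = trans (cong (_* n) (col-∷ x xs j)) (*-distribʳ-+ n [ j ≤ x ] (col xs j))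

groupSum-next≤ : ∀ n g L → groupSum n L (suc g) ≤ col L (suc g * n) * n
groupSum-next≤ n g []       = ≤-reflexive (groupSum-[] n (suc g))
groupSum-next≤ n g (x ∷ xs) =
  subst₂ _≤_ (sym (groupSum-∷ n x xs (suc g)))
             (sym (col-∷-* n x xs (suc g * n)))
         (+-mono-≤ (contribution-next≤ n g x) (groupSum-next≤ n g xs))

groupSum-this≥ : ∀ n g L → col L (suc g * n) * n ≤ groupSum n L g
groupSum-this≥ n g []       = z≤n
groupSum-this≥ n g (x ∷ xs) =
  subst₂ _≤_ (sym (col-∷-* n x xs (suc g * n)))
             (sym (groupSum-∷ n x xs g))
         (+-mono-≤ (contribution-this≥ n g x) (groupSum-this≥ n g xs))

groupSums-separated : ∀ n L g → Separated n (groupSum n L g) (groupSum n L (suc g))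
groupSums-separated n L g k kn<next =
  ≤-trans (*-monoˡ-≤ n k<A) (groupSum-this≥ n g L)
  where
  k<A : k < col L (suc g * n)
  k<A = *-cancelʳ-< n k _ (<-≤-trans kn<next (groupSum-next≤ n g L))

cn-atMostOnePerWindow : ∀ n → 1 ≤ n → ∀ L → AtMostOnePerWindow n (cn n L)
cn-atMostOnePerWindow n 1≤n L =
  pairwiseApart⇒atMostOne n (cn n L)
    (AllPairs.map separated⇒apart (Linked⇒AllPairs (separated-trans n 1≤n) linked))
  where
  groupSums : Linked (Separated n) (map (groupSum n L) (upTo (firstPart L)))
  groupSums = subst (Linked (Separated n)) (sym (map-upTo (groupSum n L) (firstPart L)))
                    (applyUpTo⁺₂ (groupSum n L) (firstPart L) (groupSums-separated n L))
  linked : Linked (Separated n) (cn n L)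
  linked = filter⁺ ≢0? (separated-trans n 1≤n) groupSums

-- Sufficiency: duality between the parts and the group sums

part : List ℕ → ℕ → ℕ
part []       h       = 0
part (x ∷ xs) zero    = x
part (x ∷ xs) (suc h) = part xs h

part-all : ∀ {P : ℕ → Set} {xs} → All P xs → P 0 → ∀ h → P (part xs h)
part-all []         p0 h       = p0
part-all (px ∷ _)   p0 zero    = px
part-all (_  ∷ pxs) p0 (suc h) = part-all pxs p0 h

Decreasing : List ℕ → Set
Decreasing = AllPairs (λ x y → y ≤ x)

part≤firstPart : ∀ {L} → Decreasing L → ∀ h → part L h ≤ firstPart L
part≤firstPart []         h       = z≤n
part≤firstPart (_    ∷ _) zero    = ≤-refl
part≤firstPart (xs≤x ∷ _) (suc h) = part-all xs≤x z≤n h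

apart-below : ∀ n g {x y} → g * n < x → x < suc g * n → y ≤ x → Apart n x y → y ≤ g * n
apart-below n g {y = y} gn<x x< y≤x x#y with y ≤? g * n
... | yes y≤gn = y≤gn
... | no  y≰gn = ⊥-elim (x#y g (gn<x , x<) (≰⇒> y≰gn , ≤-<-trans y≤x x<))

apart-above : ∀ n g {x y} → g * n < y → y ≤ x → Apart n x y → suc g * n ≤ x
apart-above n g {x} gn<y y≤x x#y with suc g * n ≤? x
... | yes ≤x = ≤x
... | no  ≰x =
  contradiction (apart-below n g (<-≤-trans gn<y y≤x) (≰⇒> ≰x) y≤x x#y) (<⇒≱ gn<y)

module Duality (n u : ℕ) (1≤u : 1 ≤ u) (u≤n : u ≤ n) where

  -- A largest part x < gn + u leaves fewer than u cells in group g: either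
  -- nothing reaches past gn, or x alone sits inside window g.
  groupSum-small : ∀ {g x xs} → All (_≤ x) xs → All (Apart n x) xs →
                   x < g * n + u → groupSum n (x ∷ xs) g < u
  groupSum-small {g} {x} {xs} xs≤x x#xs x< with x ≤? g * n
  ... | yes x≤gn =
    subst (_< u) (sym (groupSum-below n g (x≤gn ∷ All.map (λ y≤x → ≤-trans y≤x x≤gn) xs≤x)))
          1≤u
  ... | no  x≰gn = begin-strict
    groupSum n (x ∷ xs) g                ≡⟨ groupSum-∷ n x xs g ⟩
    contribution n g x + groupSum n xs g ≡⟨ cong (_ +_) (groupSum-below n g xs≤gn) ⟩
    contribution n g x + 0               ≡⟨ +-identityʳ _ ⟩
    contribution n g x                   ≤⟨ m⊓n≤n n _ ⟩
    x ∸ g * n                            <⟨ ∸-monoˡ-< x< (<⇒≤ gn<x) ⟩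
    g * n + u ∸ g * n                    ≡⟨ m+n∸m≡n (g * n) u ⟩
    u                                    ∎
    where
    open ≤-Reasoning
    gn<x : g * n < x
    gn<x = ≰⇒> x≰gn
    x<sgn : x < suc g * n
    x<sgn = <-≤-trans x< (subst (g * n + u ≤_) (+-comm (g * n) n) (+-monoʳ-≤ (g * n) u≤n))
    xs≤gn : All (_≤ g * n) xs
    xs≤gn = All.zipWith (λ (y≤x , x#y) → apart-below n g gn<x x<sgn y≤x x#y) (xs≤x , x#xs)

  -- gn + u ≤ λ_h ⇒ hn + u ≤ μ_g: the h parts before λ_h fill group g
  -- completely, and λ_h itself contributes at least u.
  part⇒groupSum : ∀ {L} → Decreasing L → AllPairs (Apart n) L →
                  ∀ g h → g * n + u ≤ part L h → h * n + u ≤ groupSum n L g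
  part⇒groupSum {[]} [] [] g h gn+u≤0 =
    contradiction gn+u≤0 (<⇒≱ (≤-trans 1≤u (m≤n+m u (g * n))))
  part⇒groupSum {x ∷ xs} _ _ g zero gn+u≤x = begin
    u                                    ≤⟨ ⊓-glb u≤n u≤x∸gn ⟩
    contribution n g x                   ≤⟨ m≤m+n _ _ ⟩
    contribution n g x + groupSum n xs g ≡⟨ groupSum-∷ n x xs g ⟨
    groupSum n (x ∷ xs) g                ∎
    where
    open ≤-Reasoning
    u≤x∸gn : u ≤ x ∸ g * n
    u≤x∸gn = m+n≤o⇒m≤o∸n u (subst (_≤ x) (+-comm (g * n) u) gn+u≤x)
  part⇒groupSum {x ∷ xs} (xs≤x ∷ dec) (x#xs ∷ apart) g (suc h) gn+u≤y = begin
    n + h * n + u                        ≡⟨ +-assoc n (h * n) u ⟩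
    n + (h * n + u)                      ≤⟨ +-monoʳ-≤ n (part⇒groupSum dec apart g h gn+u≤y) ⟩
    n + groupSum n xs g                  ≡⟨ cong (_+ _) (contribution-above n g sgn≤x) ⟨
    contribution n g x + groupSum n xs g ≡⟨ groupSum-∷ n x xs g ⟨
    groupSum n (x ∷ xs) g                ∎
    where
    open ≤-Reasoning
    sgn≤x : suc g * n ≤ x
    sgn≤x = apart-above n g (<-≤-trans (m<m+n (g * n) 1≤u) gn+u≤y)
                        (part-all xs≤x z≤n h)
                        (part-all x#xs (λ k _ (kn<0 , _) → <⇒≱ kn<0 z≤n) h)

  -- hn + u ≤ μ_g ⇒ gn + u ≤ λ_h: each earlier part contributes at most n,
  -- so λ_h is the largest part of a list whose group g still has ≥ u cells.
  groupSum⇒part : ∀ {L} → Decreasing L → AllPairs (Apart n) L →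
                  ∀ g h → h * n + u ≤ groupSum n L g → g * n + u ≤ part L h
  groupSum⇒part {[]} [] [] g h hn+u≤ =
    contradiction (subst (h * n + u ≤_) (groupSum-[] n g) hn+u≤)
                  (<⇒≱ (≤-trans 1≤u (m≤n+m u (h * n))))
  groupSum⇒part {x ∷ xs} (xs≤x ∷ _) (x#xs ∷ _) g zero u≤ with g * n + u ≤? x
  ... | yes gn+u≤x = gn+u≤x
  ... | no  gn+u≰x = contradiction u≤ (<⇒≱ (groupSum-small {g} xs≤x x#xs (≰⇒> gn+u≰x)))
  groupSum⇒part {x ∷ xs} (_ ∷ dec) (_ ∷ apart) g (suc h) sh+u≤ =
    groupSum⇒part dec apart g h (+-cancelˡ-≤ n _ _ (begin
      n + (h * n + u)                      ≡⟨ +-assoc n (h * n) u ⟨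
      suc h * n + u                        ≤⟨ sh+u≤ ⟩
      groupSum n (x ∷ xs) g                ≡⟨ groupSum-∷ n x xs g ⟩
      contribution n g x + groupSum n xs g ≤⟨ +-monoˡ-≤ _ (m⊓n≤m n _) ⟩
      n + groupSum n xs g                  ∎))
    where open ≤-Reasoning

  duality : ∀ {L} → Decreasing L → AllPairs (Apart n) L →
            ∀ g h → [ h * n + u ≤ groupSum n L g ] ≡ [ g * n + u ≤ part L h ]
  duality dec apart g h = [≤]-cong (groupSum⇒part dec apart g h) (part⇒groupSum dec apart g h)

col-dropZeros : ∀ L j → col (filter ≢0? L) (suc j) ≡ col L (suc j)
col-dropZeros []           j = refl
col-dropZeros (zero  ∷ xs) j = col-dropZeros xs j
col-dropZeros (suc x ∷ xs) j = begin
  col (suc x ∷ filter ≢0? xs) (suc j)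
    ≡⟨ col-∷ (suc x) (filter ≢0? xs) (suc j) ⟩
  [ suc j ≤ suc x ] + col (filter ≢0? xs) (suc j)
    ≡⟨ cong ([ suc j ≤ suc x ] +_) (col-dropZeros xs j) ⟩
  [ suc j ≤ suc x ] + col xs (suc j)
    ≡⟨ col-∷ (suc x) xs (suc j) ⟨
  col (suc x ∷ xs) (suc j) ∎
  where open ≡-Reasoning

col-applyUpTo : ∀ f M j → col (applyUpTo f M) j ≡ sumTo (λ g → [ j ≤ f g ]) M
col-applyUpTo f zero    j = refl
col-applyUpTo f (suc M) j =
  trans (col-∷ (f 0) (applyUpTo (f ∘ suc) M) j)
        (cong ([ j ≤ f 0 ] +_) (col-applyUpTo (f ∘ suc) M j))

col-cn : ∀ n L j → 1 ≤ j →
         col (cn n L) j ≡ sumTo (λ g → [ j ≤ groupSum n L g ]) (firstPart L)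
col-cn n L (suc j) _ = begin
  col (cn n L) (suc j)                  ≡⟨ col-dropZeros (map G (upTo M)) j ⟩
  col (map G (upTo M)) (suc j)          ≡⟨ cong (λ ys → col ys (suc j)) (map-upTo G M) ⟩
  col (applyUpTo G M) (suc j)           ≡⟨ col-applyUpTo G M (suc j) ⟩
  sumTo (λ g → [ suc j ≤ G g ]) M       ∎
  where
  open ≡-Reasoning
  G : ℕ → ℕ
  G = groupSum n L
  M : ℕ
  M = firstPart L

groupSum-cn : ∀ n → 1 ≤ n → ∀ {L} → Decreasing L → AllPairs (Apart n) L →
              ∀ h → groupSum n (cn n L) h ≡ part L h
groupSum-cn n 1≤n {L} dec apart h = begin
  groupSum n (cn n L) h
    ≡⟨ groupSum-columns n (cn n L) h ⟩
  sumTo (λ t → col (cn n L) (h * n + suc t)) n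
    ≡⟨ sumTo-cong n (λ t _ → col-cn n L (h * n + suc t) (≤-trans (s≤s z≤n) (m≤n+m (suc t) (h * n)))) ⟩
  sumTo (λ t → sumTo (λ g → [ h * n + suc t ≤ groupSum n L g ]) M) n
    ≡⟨ sumTo-cong n (λ t t<n → sumTo-cong M (λ g _ →
         Duality.duality n (suc t) (s≤s z≤n) t<n dec apart g h)) ⟩
  sumTo (λ t → sumTo (λ g → [ g * n + suc t ≤ x ]) M) n
    ≡⟨ sumTo-swap (λ t g → [ g * n + suc t ≤ x ]) n M ⟩
  sumTo (λ g → sumTo (λ t → [ g * n + suc t ≤ x ]) n) M
    ≡⟨ sumTo-cong M (λ g _ → sumTo-[≤] n (g * n) x) ⟩
  sumTo (λ g → contribution n g x) M
    ≡⟨ sumTo-contribution n M x x≤Mn ⟩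
  x ∎
  where
  open ≡-Reasoning
  M : ℕ
  M = firstPart L
  x : ℕ
  x = part L h
  x≤Mn : x ≤ M * n
  x≤Mn = ≤-trans (part≤firstPart dec h) (m≤m*n M n {{>-nonZero 1≤n}})

-- Each positive part has a cell in column 1, so μ₀ ≥ length λ.
length≤groupSum₀ : ∀ n → 1 ≤ n → ∀ {L} → All (1 ≤_) L → length L ≤ groupSum n L 0
length≤groupSum₀ n 1≤n {[]}     []          = z≤n
length≤groupSum₀ n 1≤n {x ∷ xs} (1≤x ∷ pos) =
  subst (suc (length xs) ≤_) (sym (groupSum-∷ n x xs 0))
        (+-mono-≤ (⊓-glb 1≤n 1≤x) (length≤groupSum₀ n 1≤n pos))

firstPart-dropZeros : ∀ v rest → 1 ≤ v → firstPart (filter ≢0? (v ∷ rest)) ≡ v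
firstPart-dropZeros (suc v) rest _ = refl

length≤firstPart-cn : ∀ n → 1 ≤ n → ∀ {L} → All (1 ≤_) L →
                      length L ≤ firstPart (cn n L)
length≤firstPart-cn n 1≤n {[]}         []       = z≤n
length≤firstPart-cn n 1≤n {zero ∷ _}   (() ∷ _)
length≤firstPart-cn n 1≤n {suc y ∷ ys} pos =
  subst (length (suc y ∷ ys) ≤_) (sym (firstPart-dropZeros _ _ (≤-trans (s≤s z≤n) μ₀≥len)))
        μ₀≥len
  where
  μ₀≥len : length (suc y ∷ ys) ≤ groupSum n (suc y ∷ ys) 0
  μ₀≥len = length≤groupSum₀ n 1≤n pos

dropZeros-parts : ∀ L N → All (1 ≤_) L → length L ≤ N →
                  filter ≢0? (applyUpTo (part L) N) ≡ L
dropZeros-parts []           zero    _         _           = refl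
dropZeros-parts []           (suc N) _         _           = dropZeros-parts [] N [] z≤n
dropZeros-parts (suc x ∷ xs) (suc N) (_ ∷ pos) (s≤s len≤N) =
  cong (suc x ∷_) (dropZeros-parts xs N pos len≤N)

cn-involutive : ∀ n → 1 ≤ n → ∀ L → Decreasing L → AllPairs (Apart n) L → All (1 ≤_) L →
                cn n (cn n L) ≡ L
cn-involutive n 1≤n L dec apart pos = begin
  filter ≢0? (map (groupSum n (cn n L)) (upTo M′))
    ≡⟨ cong (filter ≢0?) (map-cong (groupSum-cn n 1≤n dec apart) (upTo M′)) ⟩
  filter ≢0? (map (part L) (upTo M′))
    ≡⟨ cong (filter ≢0?) (map-upTo (part L) M′) ⟩
  filter ≢0? (applyUpTo (part L) M′)
    ≡⟨ dropZeros-parts L M′ pos (length≤firstPart-cn n 1≤n pos) ⟩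
  L ∎
  where
  open ≡-Reasoning
  M′ : ℕ
  M′ = firstPart (cn n L)

mainTheorem2 : (n : ℕ) → 1 ≤ n → (λs : List ℕ) → IsPartition λs →
    (cn n (cn n λs) ≡ λs) ⇔ AtMostOnePerWindow n λs
mainTheorem2 n 1≤n λs (linked , positive) = mk⇔ necessity sufficiency
  where
  necessity : cn n (cn n λs) ≡ λs → AtMostOnePerWindow n λs
  necessity involutive =
    subst (AtMostOnePerWindow n) involutive (cn-atMostOnePerWindow n 1≤n (cn n λs))

  decreasing : Decreasing λs
  decreasing = Linked⇒AllPairs (λ y≤x z≤y → ≤-trans z≤y y≤x) linked

  sufficiency : AtMostOnePerWindow n λs → cn n (cn n λs) ≡ λs
  sufficiency once = cn-involutive n 1≤n λs decreasing (atMostOne⇒pairwiseApart n λs once) positive
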